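{- Let $P^{\mathrm{D}}_n(t)=\sum_{k=0}^nD(n,k)t^k$ and $P^{\widetilde{\mathrm{D}}}_n(t)=\sum_{k=0}^n\widetilde{D}(n,k)t^k$. For $n\ge1$, \[P^{\mathrm{D}}_n(t)=(2nt-t+1)P^{\mathrm{D}}_{n-1}(t)+2t(1-t)\frac{d}{dt}P^{\mathrm{D}}_{n-1}(t)-t(1-t)^{n-1},\] \[P^{\widetilde{\mathrm{D}}}_n(t)=(2nt-t+1)P^{\widetilde{\mathrm{D}}}_{n-1}(t)+2t(1-t)\frac{d}{dt}P^{\widetilde{\mathrm{D}}}_{n-1}(t)+t(1-t)^{n-1}.\]
   Context: $\mathcal{B}_n$ is the group of permutations $\sigma$ of $\{ -n,\dots,n\}$ with $\sigma(-k)=-\sigma(k)$ for all $k$. For $\sigma\in\mathcal{B}_n$, $\mathrm{desc}(\sigma)$ is the number of $i\in\{0,\dots,n-1\}$ with $\sigma(i)>\sigma(i+1)$ (descends of $(0,\sigma(1),\dots,\sigma(n))$). $\mathcal{D}_n$ is the set of $\sigma\in\mathcal{B}_n$ such that $\{\sigma(1),\dots,\sigma(n)\}$ contains an even number of negative elements, and $\widetilde{\mathcal{D}}_n=\mathcal{B}_n\setminus\mathcal{D}_n$. $D(n,k)=\#\{\sigma\in\mathcal{D}_n:\mathrm{desc}(\sigma)=k\}$ and $\widetilde{D}(n,k)=\#\{\sigma\in\widetilde{\mathcal{D}}_n:\mathrm{desc}(\sigma)=k\}$. -}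

module Defs where

open import Data.Bool using (Bool; true; false; if_then_else_; _∧_; not)
open import Data.Nat as N using (ℕ; zero; suc; _≡ᵇ_; _<ᵇ_)
open import Data.Integer as ℤ using (ℤ; +_; -[1+_]; ∣_∣)
open import Relation.Binary.PropositionalEquality using (_≡_)
open import Relation.Nullary.Decidable using (⌊_⌋)
open import Data.List using (List; []; _∷_; map; concatMap; upTo; _++_)

-- Signed permutations of B_n, represented by the word (σ(1),…,σ(n)).
-- Since σ(-k) = -σ(k) (and hence σ(0) = 0), σ is determined by this
-- word, and a word arises from some σ ∈ B_n iff its entries are
-- nonzero integers in [-n,n] with pairwise distinct absolute values.

nonzeroUpTo : ℕ → List ℤ
nonzeroUpTo n = map (λ i → + suc i) (upTo n) ++ map (λ i → -[1+ i ]) (upTo n)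

words : List ℤ → ℕ → List (List ℤ)
words xs zero    = [] ∷ []
words xs (suc m) = concatMap (λ x → map (x ∷_) (words xs m)) xs

allᵇ : {A : Set} → (A → Bool) → List A → Bool
allᵇ p []       = true
allᵇ p (x ∷ xs) = p x ∧ allᵇ p xs

distinctAbs : List ℤ → Bool
distinctAbs []       = true
distinctAbs (x ∷ xs) = allᵇ (λ y → not (∣ x ∣ ≡ᵇ ∣ y ∣)) xs ∧ distinctAbs xs

filterᵇ : {A : Set} → (A → Bool) → List A → List A
filterᵇ p []       = []
filterᵇ p (x ∷ xs) = if p x then x ∷ filterᵇ p xs else filterᵇ p xs

countᵇ : {A : Set} → (A → Bool) → List A → ℕ
countᵇ p []       = 0
countᵇ p (x ∷ xs) = if p x then suc (countᵇ p xs) else countᵇ p xs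

-- the group B_n (as a list of words, each signed permutation exactly once)
B : ℕ → List (List ℤ)
B n = filterᵇ distinctAbs (words (nonzeroUpTo n) n)

descList : List ℤ → ℕ
descList []           = 0
descList (x ∷ [])     = 0
descList (x ∷ y ∷ xs) = (if ⌊ y ℤ.<? x ⌋ then 1 else 0) N.+ descList (y ∷ xs)

desc : List ℤ → ℕ
desc w = descList (+ 0 ∷ w)

isNeg : ℤ → Bool
isNeg (+ _)    = false
isNeg -[1+ _ ] = true

even : ℕ → Bool
even zero          = true
even (suc zero)    = false
even (suc (suc n)) = even n

inD : List ℤ → Bool
inD w = even (countᵇ isNeg w)

Dcount : ℕ → ℕ → ℕ
Dcount n k = countᵇ (λ w → inD w ∧ (desc w ≡ᵇ k)) (B n)

D̃count : ℕ → ℕ → ℕ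
D̃count n k = countᵇ (λ w → not (inD w) ∧ (desc w ≡ᵇ k)) (B n)

-- Polynomials in t over ℤ, represented by their coefficient sequence
-- (coefficient of t^k).  Equality of polynomials is coefficientwise.

Poly : Set
Poly = ℕ → ℤ

_≈ₚ_ : Poly → Poly → Set
p ≈ₚ q = ∀ k → p k ≡ q k

infix 4 _≈ₚ_

constₚ : ℤ → Poly
constₚ c zero    = c
constₚ c (suc _) = + 0

tₚ : Poly
tₚ zero          = + 0
tₚ (suc zero)    = + 1
tₚ (suc (suc _)) = + 0

_+ₚ_ : Poly → Poly → Poly
(p +ₚ q) k = p k ℤ.+ q k

_-ₚ_ : Poly → Poly → Poly
(p -ₚ q) k = p k ℤ.- q k

sumℤ : List ℤ → ℤ
sumℤ []       = + 0
sumℤ (x ∷ xs) = x ℤ.+ sumℤ xs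

_*ₚ_ : Poly → Poly → Poly
(p *ₚ q) k = sumℤ (map (λ i → p i ℤ.* q (k N.∸ i)) (upTo (suc k)))

infixl 6 _+ₚ_ _-ₚ_
infixl 7 _*ₚ_

_^ₚ_ : Poly → ℕ → Poly
p ^ₚ zero  = constₚ (+ 1)
p ^ₚ suc m = p *ₚ (p ^ₚ m)

deriv : Poly → Poly
deriv p k = + suc k ℤ.* p (suc k)

-- P^D_n(t) = Σ_k D(n,k) t^k  and  P^{D̃}_n(t) = Σ_k D̃(n,k) t^k
-- (D(n,k) = D̃(n,k) = 0 for k > n automatically)
PD : ℕ → Poly
PD n k = + Dcount n k

PD̃ : ℕ → Poly
PD̃ n k = + D̃count n k

module Submission where

-- For s ∈ {1, -1} put  descGen s n = Σ_{σ ∈ B_n} s^{[σ ∉ D_n]} t^{desc σ} = P^D_n + s P^D̃_n.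
-- Every signed permutation of length n+1 arises exactly once by inserting the letter ±(n+1)
-- into one of length n; tracking how this changes descents and weight gives (`insertion`)
--     descGen s (n+1) = L s n (descGen s n),    L s n P = P + s t P + (1+s) Δ n P,
-- where Δ n P = t (n P + (1-t) P').  For s = 1, L is the operator (1 + (2n+1)t) P + 2t(1-t) P'
-- of the statement (`euler-form`); for s = -1 it is multiplication by 1-t, so
-- P^D_n - P^D̃_n = (1-t)^n, a polynomial killed by Δ n (`Δ-alternating`).  The theorem
-- follows by recovering P^D_{n+1} and P^D̃_{n+1} from their sum and difference.

open import Defs
open import Data.Nat using (ℕ; suc)
open import Data.Integer using (+_)
open import Data.Product using (_×_; _,_; proj₁; proj₂)

open import Data.Bool using (Bool; true; false; if_then_else_; _∧_; not)
open import Data.Empty using (⊥-elim)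
open import Data.Integer as ℤ using (ℤ; -[1+_]; ∣_∣; _+_; _-_; _*_; -_; _<_; _<?_)
import Data.Integer.Properties as ℤP
open import Data.Integer.Tactic.RingSolver using (solve-∀)
open import Data.List using (List; []; _∷_; _++_; [_]; map; concatMap; upTo; length)
import Data.List.Properties as ListP
open import Data.List.Membership.Propositional using (_∈_)
open import Data.List.Relation.Unary.All as All using (All; []; _∷_)
open import Data.List.Relation.Unary.All.Properties using (all-upTo)
open import Data.List.Relation.Unary.Any using (here; there)
open import Data.Nat as ℕ using (zero; _≡ᵇ_)
import Data.Nat.Properties as ℕP
open import Relation.Binary.Bundles using (Setoid)
open import Relation.Binary.PropositionalEquality hiding ([_])
import Relation.Binary.Reasoning.Setoid as SetoidReasoning
open import Relation.Nullary using (¬_; yes; no)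
open import Relation.Nullary.Decidable using (⌊_⌋)

module ≈-Reasoning = SetoidReasoning (ℕ →-setoid ℤ)
open Setoid (ℕ →-setoid ℤ) using () renaming (refl to ≈-refl; sym to ≈-sym; trans to ≈-trans)

0ₚ : Poly
0ₚ _ = + 0

infixr 8 _·ₚ_
_·ₚ_ : ℤ → Poly → Poly
(c ·ₚ P) k = c * P k

shift : Poly → Poly
shift P zero    = + 0
shift P (suc k) = P k

monomial : ℕ → ℤ → Poly
monomial d c k = if d ≡ᵇ k then c else + 0

ifP : Bool → Poly → Poly
ifP b P = if b then P else 0ₚ

ΣP : {A : Set} → List A → (A → Poly) → Poly
ΣP []       f = 0ₚ
ΣP (a ∷ as) f = f a +ₚ ΣP as f

+ₚ-cong : ∀ {P P′ Q Q′} → P ≈ₚ P′ → Q ≈ₚ Q′ → P +ₚ Q ≈ₚ P′ +ₚ Q′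
+ₚ-cong e f k = cong₂ _+_ (e k) (f k)

+ₚ-congˡ : ∀ P {Q Q′} → Q ≈ₚ Q′ → P +ₚ Q ≈ₚ P +ₚ Q′
+ₚ-congˡ P e k = cong (_+_ (P k)) (e k)

+ₚ-identityʳ : (P : Poly) → P +ₚ 0ₚ ≈ₚ P
+ₚ-identityʳ P k = ℤP.+-identityʳ (P k)

record IsLinear (f : Poly → Poly) : Set where
  field
    respects : ∀ {P Q} → P ≈ₚ Q → f P ≈ₚ f Q
    +-hom    : ∀ P Q → f (P +ₚ Q) ≈ₚ f P +ₚ f Q
    ·-hom    : ∀ c P → f (c ·ₚ P) ≈ₚ c ·ₚ f P
open IsLinear

linear-0 : ∀ {f} → IsLinear f → f 0ₚ ≈ₚ 0ₚ
linear-0 {f} lin = begin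
  f 0ₚ                 ≈⟨ respects lin (λ _ → refl) ⟩
  f ((+ 0) ·ₚ 0ₚ)      ≈⟨ ·-hom lin (+ 0) 0ₚ ⟩
  (+ 0) ·ₚ f 0ₚ        ≈⟨ (λ k → ℤP.*-zeroˡ (f 0ₚ k)) ⟩
  0ₚ                   ∎
  where open ≈-Reasoning

linear-combination : ∀ {f} → IsLinear f → ∀ c P Q → f (P +ₚ c ·ₚ Q) ≈ₚ f P +ₚ c ·ₚ f Q
linear-combination {f} lin c P Q = ≈-trans (+-hom lin P (c ·ₚ Q)) (+ₚ-congˡ (f P) (·-hom lin c Q))

ΣP-linear : ∀ {f} → IsLinear f → {A : Set} (xs : List A) (g : A → Poly) →
            f (ΣP xs g) ≈ₚ ΣP xs (λ a → f (g a))
ΣP-linear lin []       g = linear-0 lin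
ΣP-linear {f} lin (x ∷ xs) g = ≈-trans (+-hom lin (g x) (ΣP xs g)) (+ₚ-congˡ (f (g x)) (ΣP-linear lin xs g))

id-linear : IsLinear (λ P → P)
id-linear = record { respects = λ e → e ; +-hom = λ _ _ → ≈-refl ; ·-hom = λ _ _ → ≈-refl }

∘-linear : ∀ {f g} → IsLinear f → IsLinear g → IsLinear (λ P → f (g P))
∘-linear {f} {g} lf lg = record
  { respects = λ e → respects lf (respects lg e)
  ; +-hom    = λ P Q → ≈-trans (respects lf (+-hom lg P Q)) (+-hom lf (g P) (g Q))
  ; ·-hom    = λ c P → ≈-trans (respects lf (·-hom lg c P)) (·-hom lf c (g P))
  }

+-linear : ∀ {f g} → IsLinear f → IsLinear g → IsLinear (λ P → f P +ₚ g P)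
+-linear {f} {g} lf lg = record
  { respects = λ e → +ₚ-cong (respects lf e) (respects lg e)
  ; +-hom    = λ P Q k → trans (cong₂ _+_ (+-hom lf P Q k) (+-hom lg P Q k))
                               (interchange (f P k) (f Q k) (g P k) (g Q k))
  ; ·-hom    = λ c P k → trans (cong₂ _+_ (·-hom lf c P k) (·-hom lg c P k))
                               (sym (ℤP.*-distribˡ-+ c (f P k) (g P k)))
  }
  where
  interchange : ∀ a b c d → (a + b) + (c + d) ≡ (a + c) + (b + d)
  interchange = solve-∀

scale-linear : ∀ c → IsLinear (c ·ₚ_)
scale-linear c = record
  { respects = λ e k → cong (c *_) (e k)
  ; +-hom    = λ P Q k → ℤP.*-distribˡ-+ c (P k) (Q k)
  ; ·-hom    = λ d P k → scalars-commute c d (P k)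
  }
  where
  scalars-commute : ∀ c d p → c * (d * p) ≡ d * (c * p)
  scalars-commute = solve-∀

shift-linear : IsLinear shift
shift-linear = record { respects = respects′ ; +-hom = +-hom′ ; ·-hom = ·-hom′ }
  where
  respects′ : ∀ {P Q} → P ≈ₚ Q → shift P ≈ₚ shift Q
  respects′ e zero    = refl
  respects′ e (suc k) = e k
  +-hom′ : ∀ P Q → shift (P +ₚ Q) ≈ₚ shift P +ₚ shift Q
  +-hom′ P Q zero    = refl
  +-hom′ P Q (suc k) = refl
  ·-hom′ : ∀ c P → shift (c ·ₚ P) ≈ₚ c ·ₚ shift P
  ·-hom′ c P zero    = sym (ℤP.*-zeroʳ c)
  ·-hom′ c P (suc k) = refl

shift-0 : shift 0ₚ ≈ₚ 0ₚ
shift-0 = linear-0 shift-linear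

ΣP-cong∈ : {A : Set} (xs : List A) {f g : A → Poly} → (∀ a → a ∈ xs → f a ≈ₚ g a) → ΣP xs f ≈ₚ ΣP xs g
ΣP-cong∈ []       e = ≈-refl
ΣP-cong∈ (x ∷ xs) e = +ₚ-cong (e x (here refl)) (ΣP-cong∈ xs (λ a a∈xs → e a (there a∈xs)))

ΣP-cong : {A : Set} (xs : List A) {f g : A → Poly} → (∀ a → f a ≈ₚ g a) → ΣP xs f ≈ₚ ΣP xs g
ΣP-cong xs e = ΣP-cong∈ xs (λ a _ → e a)

ΣP-++ : {A : Set} (xs ys : List A) (f : A → Poly) → ΣP (xs ++ ys) f ≈ₚ ΣP xs f +ₚ ΣP ys f
ΣP-++ []       ys f k = sym (ℤP.+-identityˡ _)
ΣP-++ (x ∷ xs) ys f k = trans (cong (_+_ (f x k)) (ΣP-++ xs ys f k)) (sym (ℤP.+-assoc (f x k) _ _))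

ΣP-map : {A B : Set} (h : A → B) (xs : List A) (f : B → Poly) → ΣP (map h xs) f ≈ₚ ΣP xs (λ a → f (h a))
ΣP-map h []       f k = refl
ΣP-map h (x ∷ xs) f k = cong (_+_ (f (h x) k)) (ΣP-map h xs f k)

ΣP-concatMap : {A B : Set} (g : A → List B) (xs : List A) (f : B → Poly) →
               ΣP (concatMap g xs) f ≈ₚ ΣP xs (λ a → ΣP (g a) f)
ΣP-concatMap g []       f k = refl
ΣP-concatMap g (x ∷ xs) f k =
  trans (ΣP-++ (g x) (concatMap g xs) f k) (cong (_+_ (ΣP (g x) f k)) (ΣP-concatMap g xs f k))

ΣP-filter : {A : Set} (p : A → Bool) (xs : List A) (f : A → Poly) →
            ΣP (filterᵇ p xs) f ≈ₚ ΣP xs (λ a → ifP (p a) (f a))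
ΣP-filter p []       f k = refl
ΣP-filter p (x ∷ xs) f k with p x
... | true  = cong (_+_ (f x k)) (ΣP-filter p xs f k)
... | false = trans (ΣP-filter p xs f k) (sym (ℤP.+-identityˡ _))

ΣP-+ : {A : Set} (xs : List A) (f g : A → Poly) → ΣP xs (λ a → f a +ₚ g a) ≈ₚ ΣP xs f +ₚ ΣP xs g
ΣP-+ []       f g k = refl
ΣP-+ (x ∷ xs) f g k rewrite ΣP-+ xs f g k = interchange (f x k) (g x k) (ΣP xs f k) (ΣP xs g k)
  where
  interchange : ∀ a b c d → (a + b) + (c + d) ≡ (a + c) + (b + d)
  interchange = solve-∀

ifP-∧ : (a b : Bool) (P : Poly) → ifP (a ∧ b) P ≈ₚ ifP a (ifP b P)
ifP-∧ true  b P k = refl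
ifP-∧ false b P k = refl

ifP-cong : (a : Bool) {P Q : Poly} → P ≈ₚ Q → ifP a P ≈ₚ ifP a Q
ifP-cong true  e = e
ifP-cong false e = ≈-refl

-- Δ m P = t (m P + (1 - t) P') : the coefficient of t^{k+1} is (k+1) P_{k+1} + (m-k) P_k.
Δ : ℕ → Poly → Poly
Δ m P zero    = + 0
Δ m P (suc k) = + suc k * P (suc k) + (+ m - + k) * P k

L : ℤ → ℕ → Poly → Poly
L s m P = P +ₚ s ·ₚ shift P +ₚ (+ 1 + s) ·ₚ Δ m P

Δ-linear : ∀ m → IsLinear (Δ m)
Δ-linear m = record { respects = respects′ ; +-hom = +-hom′ ; ·-hom = ·-hom′ }
  where
  respects′ : ∀ {P Q} → P ≈ₚ Q → Δ m P ≈ₚ Δ m Q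
  respects′ e zero    = refl
  respects′ e (suc k) = cong₂ (λ a b → + suc k * a + (+ m - + k) * b) (e (suc k)) (e k)
  +-hom′ : ∀ P Q → Δ m (P +ₚ Q) ≈ₚ Δ m P +ₚ Δ m Q
  +-hom′ P Q zero    = refl
  +-hom′ P Q (suc k) = distrib (+ suc k) (+ m - + k) (P (suc k)) (Q (suc k)) (P k) (Q k)
    where
    distrib : ∀ a b p₁ q₁ p₀ q₀ → a * (p₁ + q₁) + b * (p₀ + q₀) ≡ (a * p₁ + b * p₀) + (a * q₁ + b * q₀)
    distrib = solve-∀
  ·-hom′ : ∀ c P → Δ m (c ·ₚ P) ≈ₚ c ·ₚ Δ m P
  ·-hom′ c P zero    = sym (ℤP.*-zeroʳ c)
  ·-hom′ c P (suc k) = pull-out (+ suc k) (+ m - + k) c (P (suc k)) (P k)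
    where
    pull-out : ∀ a b c p₁ p₀ → a * (c * p₁) + b * (c * p₀) ≡ c * (a * p₁ + b * p₀)
    pull-out = solve-∀

L-linear : ∀ s m → IsLinear (L s m)
L-linear s m = +-linear (+-linear id-linear (∘-linear (scale-linear s) shift-linear))
                        (∘-linear (scale-linear (+ 1 + s)) (Δ-linear m))

Δ-one : Δ 0 (constₚ (+ 1)) ≈ₚ 0ₚ
Δ-one zero          = refl
Δ-one (suc zero)    = refl
Δ-one (suc (suc k)) = zeros (+ suc (suc k)) (+ 0 - + suc k)
  where
  zeros : ∀ a b → a * + 0 + b * + 0 ≡ + 0
  zeros = solve-∀

L-on-kernel : ∀ s m P → Δ m P ≈ₚ 0ₚ → L s m P ≈ₚ P +ₚ s ·ₚ shift P
L-on-kernel s m P ΔP≈0 k =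
  trans (cong (λ d → P k + s * shift P k + (+ 1 + s) * d) (ΔP≈0 k))
        (trans (cong (_+_ (P k + s * shift P k)) (ℤP.*-zeroʳ (+ 1 + s))) (ℤP.+-identityʳ _))

L-suc : ∀ s m P → L s (suc m) P ≈ₚ L s m P +ₚ (+ 1 + s) ·ₚ shift P
L-suc s m P zero    = identity (P 0) s
  where
  identity : ∀ p s → p + s * + 0 + (+ 1 + s) * + 0 ≡ (p + s * + 0 + (+ 1 + s) * + 0) + (+ 1 + s) * + 0
  identity = solve-∀
L-suc s m P (suc k) = identity (+ k) (+ m) s (P (suc k)) (P k)
  where
  identity : ∀ K M s p₁ p₀ →
    p₁ + s * p₀ + (+ 1 + s) * ((+ 1 + K) * p₁ + ((+ 1 + M) - K) * p₀)
      ≡ (p₁ + s * p₀ + (+ 1 + s) * ((+ 1 + K) * p₁ + (M - K) * p₀)) + (+ 1 + s) * p₀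
  identity = solve-∀

L-suc-shift : ∀ s m P → L s (suc m) (shift P) ≈ₚ shift (L s m P) +ₚ (+ 1 + s) ·ₚ shift P
L-suc-shift s m P zero = identity s
  where
  identity : ∀ s → + 0 + s * + 0 + (+ 1 + s) * + 0 ≡ + 0 + (+ 1 + s) * + 0
  identity = solve-∀
L-suc-shift s m P (suc zero) = identity (+ m) s (P 0)
  where
  identity : ∀ M s p₀ → p₀ + s * + 0 + (+ 1 + s) * (+ 1 * p₀ + ((+ 1 + M) - + 0) * + 0)
                          ≡ (p₀ + s * + 0 + (+ 1 + s) * + 0) + (+ 1 + s) * p₀
  identity = solve-∀
L-suc-shift s m P (suc (suc k)) = identity (+ k) (+ m) s (P (suc k)) (P k)
  where
  identity : ∀ K M s p₁ p₀ →
    p₁ + s * p₀ + (+ 1 + s) * ((+ 1 + (+ 1 + K)) * p₁ + ((+ 1 + M) - (+ 1 + K)) * p₀)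
      ≡ (p₁ + s * p₀ + (+ 1 + s) * ((+ 1 + K) * p₁ + (M - K) * p₀)) + (+ 1 + s) * p₁
  identity = solve-∀

descShift : ℤ → ℤ → Poly → Poly
descShift x y P = if ⌊ y <? x ⌋ then shift P else P

descShift-linear : ∀ x y → IsLinear (descShift x y)
descShift-linear x y with ⌊ y <? x ⌋
... | true  = shift-linear
... | false = id-linear

descShift-desc : ∀ {x y} P → y < x → descShift x y P ≈ₚ shift P
descShift-desc {x} {y} P y<x with y <? x
... | yes _   = ≈-refl
... | no  y≮x = ⊥-elim (y≮x y<x)

descShift-asc : ∀ {x y} P → ¬ y < x → descShift x y P ≈ₚ P
descShift-asc {x} {y} P y≮x with y <? x
... | yes y<x = ⊥-elim (y≮x y<x)
... | no  _   = ≈-refl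

L-descShift : ∀ s m x y P → L s (suc m) (descShift x y P) ≈ₚ descShift x y (L s m P) +ₚ (+ 1 + s) ·ₚ shift P
L-descShift s m x y P with ⌊ y <? x ⌋
... | true  = L-suc-shift s m P
... | false = L-suc s m P

regroup : ∀ s c (U V A B : Poly) →
  (U +ₚ c ·ₚ shift A) +ₚ s ·ₚ (V +ₚ c ·ₚ shift B) ≈ₚ (U +ₚ s ·ₚ V) +ₚ c ·ₚ shift (A +ₚ s ·ₚ B)
regroup s c U V A B zero    = identity s c (U 0) (V 0)
  where
  identity : ∀ s c u v → (u + c * + 0) + s * (v + c * + 0) ≡ (u + s * v) + c * + 0
  identity = solve-∀
regroup s c U V A B (suc k) = identity s c (U (suc k)) (V (suc k)) (A k) (B k)
  where
  identity : ∀ s c u v a b → (u + c * a) + s * (v + c * b) ≡ (u + s * v) + c * (a + s * b)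
  identity = solve-∀

filter-++ : {A : Set} (p : A → Bool) (xs ys : List A) → filterᵇ p (xs ++ ys) ≡ filterᵇ p xs ++ filterᵇ p ys
filter-++ p []       ys = refl
filter-++ p (x ∷ xs) ys with p x
... | true  = cong (x ∷_) (filter-++ p xs ys)
... | false = filter-++ p xs ys

filter-map : {A B : Set} (p : B → Bool) (f : A → B) (xs : List A) →
             filterᵇ p (map f xs) ≡ map f (filterᵇ (λ a → p (f a)) xs)
filter-map p f []       = refl
filter-map p f (x ∷ xs) with p (f x)
... | true  = cong (f x ∷_) (filter-map p f xs)
... | false = filter-map p f xs

filter-all-allowed : (p : ℤ → Bool) (a : ℤ) → p a ≡ true → (ws : List (List ℤ)) →
                     filterᵇ (allᵇ p) (map (a ∷_) ws) ≡ map (a ∷_) (filterᵇ (allᵇ p) ws)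
filter-all-allowed p a pa []       = refl
filter-all-allowed p a pa (w ∷ ws) rewrite pa with allᵇ p w
... | true  = cong ((a ∷ w) ∷_) (filter-all-allowed p a pa ws)
... | false = filter-all-allowed p a pa ws

filter-all-forbidden : (p : ℤ → Bool) (a : ℤ) → p a ≡ false → (ws : List (List ℤ)) →
                       filterᵇ (allᵇ p) (map (a ∷_) ws) ≡ []
filter-all-forbidden p a pa []       = refl
filter-all-forbidden p a pa (w ∷ ws) rewrite pa = filter-all-forbidden p a pa ws

filter-all-words : (p : ℤ → Bool) (A : List ℤ) (n : ℕ) → filterᵇ (allᵇ p) (words A n) ≡ words (filterᵇ p A) n
filter-all-words p A zero    = refl
filter-all-words p A (suc n) = by-first-letter A
  where
  by-first-letter : (A′ : List ℤ) →
    filterᵇ (allᵇ p) (concatMap (λ y → map (y ∷_) (words A n)) A′)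
      ≡ concatMap (λ y → map (y ∷_) (words (filterᵇ p A) n)) (filterᵇ p A′)
  by-first-letter []       = refl
  by-first-letter (a ∷ A′) with p a in pa
  ... | true  = trans (filter-++ (allᵇ p) (map (a ∷_) (words A n)) _)
                      (cong₂ _++_ (trans (filter-all-allowed p a pa (words A n))
                                         (cong (map (a ∷_)) (filter-all-words p A n)))
                                  (by-first-letter A′))
  ... | false = trans (filter-++ (allᵇ p) (map (a ∷_) (words A n)) _)
                      (cong₂ _++_ (filter-all-forbidden p a pa (words A n)) (by-first-letter A′))

signed : List ℕ → List ℤ
signed S = map (λ i → + suc i) S ++ map -[1+_] S

remove : ℕ → List ℕ → List ℕ
remove a S = filterᵇ (λ b → not (a ≡ᵇ b)) S

filter-signed : ∀ a S → filterᵇ (λ z → not (suc a ≡ᵇ ∣ z ∣)) (signed S) ≡ signed (remove a S)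
filter-signed a S =
  trans (filter-++ (λ z → not (suc a ≡ᵇ ∣ z ∣)) (map (λ i → + suc i) S) (map -[1+_] S))
        (cong₂ _++_ (filter-map (λ z → not (suc a ≡ᵇ ∣ z ∣)) (λ i → + suc i) S)
                    (filter-map (λ z → not (suc a ≡ᵇ ∣ z ∣)) -[1+_] S))

≡ᵇ-refl : ∀ a → (a ≡ᵇ a) ≡ true
≡ᵇ-refl zero    = refl
≡ᵇ-refl (suc a) = ≡ᵇ-refl a

<⇒≢ᵇ : ∀ {a b} → a ℕ.< b → (a ≡ᵇ b) ≡ false
<⇒≢ᵇ {zero}  {suc b} _             = refl
<⇒≢ᵇ {suc a} {suc b} (ℕ.s≤s a<b) = <⇒≢ᵇ a<b

>⇒≢ᵇ : ∀ {a b} → a ℕ.< b → (b ≡ᵇ a) ≡ false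
>⇒≢ᵇ {zero}  {suc b} _             = refl
>⇒≢ᵇ {suc a} {suc b} (ℕ.s≤s a<b) = >⇒≢ᵇ a<b

length-filter : {A : Set} (p : A → Bool) (xs : List A) → length (filterᵇ p xs) ℕ.≤ length xs
length-filter p []       = ℕ.z≤n
length-filter p (x ∷ xs) with p x
... | true  = ℕ.s≤s (length-filter p xs)
... | false = ℕP.m≤n⇒m≤1+n (length-filter p xs)

length-remove : ∀ a S → a ∈ S → length (remove a S) ℕ.< length S
length-remove a (.a ∷ S) (here refl) rewrite ≡ᵇ-refl a = ℕ.s≤s (length-filter _ S)
length-remove a (b ∷ S)  (there a∈S) with not (a ≡ᵇ b)
... | true  = ℕ.s≤s (length-remove a S a∈S)
... | false = ℕP.m≤n⇒m≤1+n (length-remove a S a∈S)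

All-filter : {A : Set} {P : A → Set} (p : A → Bool) {xs : List A} → All P xs → All P (filterᵇ p xs)
All-filter p []                = []
All-filter p {x ∷ xs} (px ∷ pxs) with p x
... | true  = px ∷ All-filter p pxs
... | false = All-filter p pxs

remove-below-top : ∀ {a M} S → a ℕ.< M → remove a (S ++ [ M ]) ≡ remove a S ++ [ M ]
remove-below-top {a} {M} S a<M rewrite filter-++ (λ b → not (a ≡ᵇ b)) S [ M ] | <⇒≢ᵇ a<M = refl

remove-absent : ∀ {M} S → All (ℕ._< M) S → remove M S ≡ S
remove-absent []      []            = refl
remove-absent (b ∷ S) (b<M ∷ S<M) rewrite >⇒≢ᵇ b<M = cong (b ∷_) (remove-absent S S<M)

remove-top : ∀ M S → All (ℕ._< M) S → remove M (S ++ [ M ]) ≡ S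
remove-top M S S<M
  rewrite filter-++ (λ b → not (M ≡ᵇ b)) S [ M ] | ≡ᵇ-refl M | remove-absent S S<M = ListP.++-identityʳ S

-- One more negative letter switches membership in D.
even-suc : ∀ c → even (suc c) ≡ not (even c)
even-suc zero          = refl
even-suc (suc zero)    = refl
even-suc (suc (suc c)) = even-suc c

monomial-step : ∀ (b : Bool) d c a →
  monomial ((if b then 1 else 0) ℕ.+ d) (c * a) ≈ₚ c ·ₚ (if b then shift (monomial d a) else monomial d a)
monomial-step true  d c a zero    = sym (ℤP.*-zeroʳ c)
monomial-step true  d c a (suc k) with d ≡ᵇ k
... | true  = refl
... | false = sym (ℤP.*-zeroʳ c)
monomial-step false d c a k with d ≡ᵇ k
... | true  = refl
... | false = sym (ℤP.*-zeroʳ c)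

module Weighted (s : ℤ) (s²≡1 : s * s ≡ + 1) where

  -- The weight of a word: 1 on D-words, s on the others (= s^{#negative letters}).
  weight : List ℤ → ℤ
  weight w = if inD w then + 1 else s

  letterWeight : ℤ → ℤ
  letterWeight y = if isNeg y then s else + 1

  -- The weight is multiplicative; this is where s² = 1 is used.
  weight-cons : ∀ y w → weight (y ∷ w) ≡ letterWeight y * weight w
  weight-cons (+ n)    w = sym (ℤP.*-identityˡ _)
  weight-cons -[1+ n ] w rewrite even-suc (countᵇ isNeg w) with even (countᵇ isNeg w)
  ... | true  = sym (ℤP.*-identityʳ s)
  ... | false = sym s²≡1

  term : ℤ → List ℤ → Poly
  term x w = monomial (descList (x ∷ w)) (weight w)

  term-cons : ∀ x y w → term x (y ∷ w) ≈ₚ letterWeight y ·ₚ descShift x y (term y w)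
  term-cons x y w k rewrite weight-cons y w =
    monomial-step ⌊ y <? x ⌋ (descList (y ∷ w)) (letterWeight y) (weight w) k

  wordPoly : ℤ → List ℤ → ℕ → Poly
  wordPoly x A n = ΣP (filterᵇ distinctAbs (words A n)) (term x)

  avoids : ℤ → ℤ → Bool
  avoids y z = not (∣ y ∣ ≡ᵇ ∣ z ∣)

  wordPoly-suc : ∀ x A n →
    wordPoly x A (suc n) ≈ₚ ΣP A (λ y → letterWeight y ·ₚ descShift x y (wordPoly y (filterᵇ (avoids y) A) n))
  wordPoly-suc x A n = begin
    ΣP (filterᵇ distinctAbs (concatMap (λ y → map (y ∷_) (words A n)) A)) (term x)
      ≈⟨ ΣP-filter distinctAbs (concatMap (λ y → map (y ∷_) (words A n)) A) (term x) ⟩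
    ΣP (concatMap (λ y → map (y ∷_) (words A n)) A) (λ w → ifP (distinctAbs w) (term x w))
      ≈⟨ ΣP-concatMap _ A _ ⟩
    ΣP A (λ y → ΣP (map (y ∷_) (words A n)) (λ w → ifP (distinctAbs w) (term x w)))
      ≈⟨ ΣP-cong A (λ y → ΣP-map (y ∷_) (words A n) _) ⟩
    ΣP A (λ y → ΣP (words A n) (λ w → ifP (distinctAbs (y ∷ w)) (term x (y ∷ w))))
      ≈⟨ ΣP-cong A first ⟩
    ΣP A (λ y → letterWeight y ·ₚ descShift x y (wordPoly y (filterᵇ (avoids y) A) n)) ∎
    where
    open ≈-Reasoning
    first : ∀ y → ΣP (words A n) (λ w → ifP (distinctAbs (y ∷ w)) (term x (y ∷ w)))
                  ≈ₚ letterWeight y ·ₚ descShift x y (wordPoly y (filterᵇ (avoids y) A) n)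
    first y = begin
      ΣP (words A n) (λ w → ifP (distinctAbs (y ∷ w)) (term x (y ∷ w)))
        ≈⟨ ΣP-cong (words A n) (λ w → ≈-trans (ifP-∧ (allᵇ (avoids y) w) (distinctAbs w) _)
             (ifP-cong (allᵇ (avoids y) w) (ifP-cong (distinctAbs w) (term-cons x y w)))) ⟩
      ΣP (words A n) (λ w → ifP (allᵇ (avoids y) w) (ifP (distinctAbs w) (f w)))
        ≈⟨ ≈-sym (ΣP-filter (allᵇ (avoids y)) (words A n) _) ⟩
      ΣP (filterᵇ (allᵇ (avoids y)) (words A n)) (λ w → ifP (distinctAbs w) (f w))
        ≈⟨ (λ k → cong (λ ws → ΣP ws (λ w → ifP (distinctAbs w) (f w)) k) (filter-all-words (avoids y) A n)) ⟩
      ΣP (words A′ n) (λ w → ifP (distinctAbs w) (f w))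
        ≈⟨ ≈-sym (ΣP-filter distinctAbs (words A′ n) f) ⟩
      ΣP (filterᵇ distinctAbs (words A′ n)) f
        ≈⟨ ≈-sym (ΣP-linear (∘-linear (scale-linear (letterWeight y)) (descShift-linear x y))
                            (filterᵇ distinctAbs (words A′ n)) (term y)) ⟩
      letterWeight y ·ₚ descShift x y (wordPoly y A′ n) ∎
      where
      A′ : List ℤ
      A′ = filterᵇ (avoids y) A
      f : List ℤ → Poly
      f w = letterWeight y ·ₚ descShift x y (term y w)

  signedPoly : ℤ → List ℕ → ℕ → Poly
  signedPoly x S n = wordPoly x (signed S) n

  signedPoly-zero : ∀ x S → signedPoly x S 0 ≈ₚ constₚ (+ 1)
  signedPoly-zero x S zero    = refl
  signedPoly-zero x S (suc k) = refl

  startingWith : ℤ → ℕ → List ℕ → ℕ → Poly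
  startingWith x a R n = descShift x (+ suc a) (signedPoly (+ suc a) R n)
                         +ₚ s ·ₚ descShift x -[1+ a ] (signedPoly -[1+ a ] R n)

  signedPoly-suc : ∀ x S n → signedPoly x S (suc n) ≈ₚ ΣP S (λ a → startingWith x a (remove a S) n)
  signedPoly-suc x S n = begin
    signedPoly x S (suc n)
      ≈⟨ wordPoly-suc x (signed S) n ⟩
    ΣP (signed S) f
      ≈⟨ ΣP-++ (map (λ i → + suc i) S) (map -[1+_] S) f ⟩
    ΣP (map (λ i → + suc i) S) f +ₚ ΣP (map -[1+_] S) f
      ≈⟨ +ₚ-cong (ΣP-map (λ i → + suc i) S f) (ΣP-map -[1+_] S f) ⟩
    ΣP S (λ a → f (+ suc a)) +ₚ ΣP S (λ a → f -[1+ a ])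
      ≈⟨ ≈-sym (ΣP-+ S (λ a → f (+ suc a)) (λ a → f -[1+ a ])) ⟩
    ΣP S (λ a → f (+ suc a) +ₚ f -[1+ a ])
      ≈⟨ ΣP-cong S (λ a → +ₚ-cong
           (λ k → trans (ℤP.*-identityˡ _) (cong (λ A → descShift x (+ suc a) (wordPoly (+ suc a) A n) k) (filter-signed a S)))
           (λ k → cong (λ A → s * descShift x -[1+ a ] (wordPoly -[1+ a ] A n) k) (filter-signed a S))) ⟩
    ΣP S (λ a → startingWith x a (remove a S) n) ∎
    where
    open ≈-Reasoning
    f : ℤ → Poly
    f y = letterWeight y ·ₚ descShift x y (wordPoly y (filterᵇ (avoids y) (signed S)) n)

  tails : ℕ → List ℕ → ℕ → Poly
  tails a R n = signedPoly (+ suc a) R n +ₚ s ·ₚ signedPoly -[1+ a ] R n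

  -- all words of length n+1 over ±(S+1), the first position never counted as a descent
  tailPoly : List ℕ → ℕ → Poly
  tailPoly S n = ΣP S (λ a → tails a (remove a S) n)

  first-above : ∀ x S n → (∀ a → a ∈ S → + suc a < x) → signedPoly x S (suc n) ≈ₚ shift (tailPoly S n)
  first-above x S n above = begin
    signedPoly x S (suc n)
      ≈⟨ signedPoly-suc x S n ⟩
    ΣP S (λ a → startingWith x a (remove a S) n)
      ≈⟨ ΣP-cong∈ S (λ a a∈S → +ₚ-cong (descShift-desc _ (above a a∈S))
           (respects (scale-linear s) (descShift-desc _ (ℤP.<-trans ℤ.-<+ (above a a∈S))))) ⟩
    ΣP S (λ a → shift (signedPoly (+ suc a) (remove a S) n) +ₚ s ·ₚ shift (signedPoly -[1+ a ] (remove a S) n))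
      ≈⟨ ΣP-cong S (λ a → ≈-sym (linear-combination shift-linear s _ _)) ⟩
    ΣP S (λ a → shift (tails a (remove a S) n))
      ≈⟨ ≈-sym (ΣP-linear shift-linear S _) ⟩
    shift (tailPoly S n) ∎
    where open ≈-Reasoning

  first-below : ∀ x S n → (∀ a → a ∈ S → x < -[1+ a ]) → signedPoly x S (suc n) ≈ₚ tailPoly S n
  first-below x S n below = ≈-trans (signedPoly-suc x S n) (ΣP-cong∈ S (λ a a∈S →
    +ₚ-cong (descShift-asc _ (ℤP.<-asym (ℤP.<-trans (below a a∈S) ℤ.-<+)))
            (respects (scale-linear s) (descShift-asc _ (ℤP.<-asym (below a a∈S))))))

  L-startingWith : ∀ n x a R →
    L s (suc n) (startingWith x a R n)
      ≈ₚ (descShift x (+ suc a) (L s n (signedPoly (+ suc a) R n))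
           +ₚ s ·ₚ descShift x -[1+ a ] (L s n (signedPoly -[1+ a ] R n)))
         +ₚ (+ 1 + s) ·ₚ shift (tails a R n)
  L-startingWith n x a R = begin
    L s (suc n) (startingWith x a R n)
      ≈⟨ linear-combination (L-linear s (suc n)) s (descShift x (+ suc a) Pos) (descShift x -[1+ a ] Neg) ⟩
    L s (suc n) (descShift x (+ suc a) Pos) +ₚ s ·ₚ L s (suc n) (descShift x -[1+ a ] Neg)
      ≈⟨ +ₚ-cong (L-descShift s n x (+ suc a) Pos) (respects (scale-linear s) (L-descShift s n x -[1+ a ] Neg)) ⟩
    (descShift x (+ suc a) (L s n Pos) +ₚ (+ 1 + s) ·ₚ shift Pos)
      +ₚ s ·ₚ (descShift x -[1+ a ] (L s n Neg) +ₚ (+ 1 + s) ·ₚ shift Neg)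
      ≈⟨ regroup s (+ 1 + s) (descShift x (+ suc a) (L s n Pos)) (descShift x -[1+ a ] (L s n Neg)) Pos Neg ⟩
    (descShift x (+ suc a) (L s n Pos) +ₚ s ·ₚ descShift x -[1+ a ] (L s n Neg))
      +ₚ (+ 1 + s) ·ₚ shift (tails a R n) ∎
    where
    open ≈-Reasoning
    Pos Neg : Poly
    Pos = signedPoly (+ suc a) R n
    Neg = signedPoly -[1+ a ] R n

  -- The words starting with a new largest letter ±(M+1): +(M+1) follows x with an ascent and
  -- is followed by a descent, -(M+1) the other way round; so both contribute t · tailPoly S n.
  startingWith-top : ∀ n x S M → All (ℕ._< M) S → -[1+ M ] < x → x < + suc M →
                     startingWith x M S (suc n) ≈ₚ (+ 1 + s) ·ₚ shift (tailPoly S n)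
  startingWith-top n x S M S<M lo hi = begin
    startingWith x M S (suc n)
      ≈⟨ +ₚ-cong (descShift-asc _ (ℤP.<-asym hi)) (respects (scale-linear s) (descShift-desc _ lo)) ⟩
    signedPoly (+ suc M) S (suc n) +ₚ s ·ₚ shift (signedPoly -[1+ M ] S (suc n))
      ≈⟨ +ₚ-cong (first-above (+ suc M) S n (λ a a∈S → ℤ.+<+ (ℕ.s≤s (All.lookup S<M a∈S))))
                 (respects (scale-linear s) (respects shift-linear
                   (first-below -[1+ M ] S n (λ a a∈S → ℤ.-<- (All.lookup S<M a∈S))))) ⟩
    shift (tailPoly S n) +ₚ s ·ₚ shift (tailPoly S n)
      ≈⟨ (λ k → factor s (shift (tailPoly S n) k)) ⟩
    (+ 1 + s) ·ₚ shift (tailPoly S n) ∎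
    where
    open ≈-Reasoning
    factor : ∀ s h → h + s * h ≡ (+ 1 + s) * h
    factor = solve-∀

  -- Insertion lemma: adjoining a new largest absolute value M+1 to the alphabet applies
  -- the operator L (for words read after a letter x strictly between ±(M+1)).
  insertion : ∀ n S M x → length S ℕ.≤ n → All (ℕ._< M) S → -[1+ M ] < x → x < + suc M →
              signedPoly x (S ++ [ M ]) (suc n) ≈ₚ L s n (signedPoly x S n)
  insertion zero [] M x _ _ lo hi = begin
    signedPoly x [ M ] 1
      ≈⟨ ≈-trans (signedPoly-suc x [ M ] 0) (+ₚ-identityʳ _) ⟩
    startingWith x M (remove M [ M ]) 0
      ≈⟨ +ₚ-cong (descShift-asc _ (ℤP.<-asym hi)) (respects (scale-linear s) (descShift-desc _ lo)) ⟩
    signedPoly (+ suc M) (remove M [ M ]) 0 +ₚ s ·ₚ shift (signedPoly -[1+ M ] (remove M [ M ]) 0)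
      ≈⟨ +ₚ-cong (signedPoly-zero (+ suc M) (remove M [ M ]))
                 (respects (scale-linear s) (respects shift-linear (signedPoly-zero -[1+ M ] (remove M [ M ])))) ⟩
    constₚ (+ 1) +ₚ s ·ₚ shift (constₚ (+ 1))
      ≈⟨ ≈-sym (L-on-kernel s 0 (constₚ (+ 1)) Δ-one) ⟩
    L s 0 (constₚ (+ 1))
      ≈⟨ respects (L-linear s 0) (≈-sym (signedPoly-zero x [])) ⟩
    L s 0 (signedPoly x [] 0) ∎
    where open ≈-Reasoning
  insertion (suc n) S M x len S<M lo hi = begin
    signedPoly x (S ++ [ M ]) (suc (suc n))
      ≈⟨ signedPoly-suc x (S ++ [ M ]) (suc n) ⟩
    ΣP (S ++ [ M ]) (λ a → startingWith x a (remove a (S ++ [ M ])) (suc n))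
      ≈⟨ ΣP-++ S [ M ] _ ⟩
    ΣP S (λ a → startingWith x a (remove a (S ++ [ M ])) (suc n))
      +ₚ (startingWith x M (remove M (S ++ [ M ])) (suc n) +ₚ 0ₚ)
      ≈⟨ +ₚ-cong (ΣP-cong∈ S lower) (≈-trans (+ₚ-identityʳ _) top) ⟩
    ΣP S X +ₚ c ·ₚ shift (tailPoly S n)
      ≈⟨ +ₚ-congˡ (ΣP S X) (ΣP-linear (∘-linear (scale-linear c) shift-linear) S Y) ⟩
    ΣP S X +ₚ ΣP S (λ a → c ·ₚ shift (Y a))
      ≈⟨ ≈-sym (ΣP-+ S X _) ⟩
    ΣP S (λ a → X a +ₚ c ·ₚ shift (Y a))
      ≈⟨ ≈-sym (ΣP-cong S (λ a → L-startingWith n x a (remove a S))) ⟩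
    ΣP S (λ a → L s (suc n) (startingWith x a (remove a S) n))
      ≈⟨ ≈-sym (ΣP-linear (L-linear s (suc n)) S _) ⟩
    L s (suc n) (ΣP S (λ a → startingWith x a (remove a S) n))
      ≈⟨ respects (L-linear s (suc n)) (≈-sym (signedPoly-suc x S n)) ⟩
    L s (suc n) (signedPoly x S (suc n)) ∎
    where
    open ≈-Reasoning
    c : ℤ
    c = + 1 + s
    Y X : ℕ → Poly
    Y a = tails a (remove a S) n
    X a = descShift x (+ suc a) (L s n (signedPoly (+ suc a) (remove a S) n))
          +ₚ s ·ₚ descShift x -[1+ a ] (L s n (signedPoly -[1+ a ] (remove a S) n))

    lower : ∀ a → a ∈ S → startingWith x a (remove a (S ++ [ M ])) (suc n) ≈ₚ X a
    lower a a∈S = ≈-trans (λ k → cong (λ R → startingWith x a R (suc n) k) (remove-below-top S a<M))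
      (+ₚ-cong (respects (descShift-linear x (+ suc a)) (ih (+ suc a) ℤ.-<+ (ℤ.+<+ (ℕ.s≤s a<M))))
               (respects (scale-linear s) (respects (descShift-linear x -[1+ a ]) (ih -[1+ a ] (ℤ.-<- a<M) ℤ.-<+))))
      where
      a<M : a ℕ.< M
      a<M = All.lookup S<M a∈S
      ih : ∀ y → -[1+ M ] < y → y < + suc M →
           signedPoly y (remove a S ++ [ M ]) (suc n) ≈ₚ L s n (signedPoly y (remove a S) n)
      ih y = insertion n (remove a S) M y (ℕP.≤-pred (ℕP.≤-trans (length-remove a S a∈S) len)) (All-filter _ S<M)

    top : startingWith x M (remove M (S ++ [ M ])) (suc n) ≈ₚ c ·ₚ shift (tailPoly S n)
    top = ≈-trans (λ k → cong (λ R → startingWith x M R (suc n) k) (remove-top M S S<M))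
                  (startingWith-top n x S M S<M lo hi)

  descGen : ℕ → Poly
  descGen n = signedPoly (+ 0) (upTo n) n

  descGen-zero : descGen 0 ≈ₚ constₚ (+ 1)
  descGen-zero = signedPoly-zero (+ 0) []

  descGen-suc : ∀ n → descGen (suc n) ≈ₚ L s n (descGen n)
  descGen-suc n = ≈-trans (λ k → cong (λ S → signedPoly (+ 0) S (suc n) k) (sym (ListP.upTo-∷ʳ n)))
    (insertion n (upTo n) n (+ 0) (ℕP.≤-reflexive (ListP.length-upTo n)) (all-upTo n) ℤ.-<+ (ℤ.+<+ (ℕ.s≤s ℕ.z≤n)))

  descGen-count : ∀ n → descGen n ≈ₚ PD n +ₚ s ·ₚ PD̃ n
  descGen-count n k = count (B n)
    where
    #D #D̃ : List (List ℤ) → ℤ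
    #D  ws = + countᵇ (λ w → inD w ∧ (desc w ≡ᵇ k)) ws
    #D̃ ws = + countᵇ (λ w → not (inD w) ∧ (desc w ≡ᵇ k)) ws
    count : ∀ ws → ΣP ws (term (+ 0)) k ≡ #D ws + s * #D̃ ws
    count [] = no-words s
      where
      no-words : ∀ s → + 0 ≡ + 0 + s * + 0
      no-words = solve-∀
    count (w ∷ ws) with inD w | desc w ≡ᵇ k
    ... | true  | true  = trans (cong (_+_ (+ 1)) (count ws)) (one-more-D s (#D ws) (#D̃ ws))
      where
      one-more-D : ∀ s a b → + 1 + (a + s * b) ≡ (+ 1 + a) + s * b
      one-more-D = solve-∀
    ... | false | true  = trans (cong (_+_ s) (count ws)) (one-more-D̃ s (#D ws) (#D̃ ws))
      where
      one-more-D̃ : ∀ s a b → s + (a + s * b) ≡ a + s * (+ 1 + b)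
      one-more-D̃ = solve-∀
    ... | true  | false = trans (ℤP.+-identityˡ _) (count ws)
    ... | false | false = trans (ℤP.+-identityˡ _) (count ws)

L-minus : ∀ m P → L (- + 1) m P ≈ₚ P -ₚ shift P
L-minus m P k = identity (P k) (shift P k) (Δ m P k)
  where
  identity : ∀ p q d → p + - + 1 * q + (+ 1 + - + 1) * d ≡ p - q
  identity = solve-∀

Δ-suc-oneMinusT : ∀ m P → Δ (suc m) (P -ₚ shift P) ≈ₚ Δ m P -ₚ shift (Δ m P)
Δ-suc-oneMinusT m P zero          = refl
Δ-suc-oneMinusT m P (suc zero)    = identity (+ m) (P 1) (P 0)
  where
  identity : ∀ M p₁ p₀ → + 1 * (p₁ - p₀) + ((+ 1 + M) - + 0) * (p₀ - + 0) ≡ (+ 1 * p₁ + (M - + 0) * p₀) - + 0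
  identity = solve-∀
Δ-suc-oneMinusT m P (suc (suc k)) = identity (+ k) (+ m) (P (suc (suc k))) (P (suc k)) (P k)
  where
  identity : ∀ K M p₂ p₁ p₀ →
    (+ 1 + (+ 1 + K)) * (p₂ - p₁) + ((+ 1 + M) - (+ 1 + K)) * (p₁ - p₀)
      ≡ ((+ 1 + (+ 1 + K)) * p₂ + (M - (+ 1 + K)) * p₁) - ((+ 1 + K) * p₁ + (M - K) * p₀)
  identity = solve-∀

alternating : ℕ → Poly
alternating = Weighted.descGen (- + 1) refl

alternating-suc : ∀ m → alternating (suc m) ≈ₚ alternating m -ₚ shift (alternating m)
alternating-suc m = ≈-trans (Weighted.descGen-suc (- + 1) refl m) (L-minus m (alternating m))

-- The derivative identity  m (1-t)^m + (1-t) d/dt (1-t)^m = 0.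
Δ-alternating : ∀ m → Δ m (alternating m) ≈ₚ 0ₚ
Δ-alternating zero    = ≈-trans (respects (Δ-linear 0) (Weighted.descGen-zero (- + 1) refl)) Δ-one
Δ-alternating (suc m) = begin
  Δ (suc m) (alternating (suc m))
    ≈⟨ respects (Δ-linear (suc m)) (alternating-suc m) ⟩
  Δ (suc m) (alternating m -ₚ shift (alternating m))
    ≈⟨ Δ-suc-oneMinusT m (alternating m) ⟩
  Δ m (alternating m) -ₚ shift (Δ m (alternating m))
    ≈⟨ (λ k → cong₂ _-_ (Δ-alternating m k) (≈-trans (respects shift-linear (Δ-alternating m)) shift-0 k)) ⟩
  0ₚ ∎
  where open ≈-Reasoning

coeffs : List ℤ → Poly
coeffs []       _       = + 0
coeffs (c ∷ cs) zero    = c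
coeffs (c ∷ cs) (suc k) = coeffs cs k

mulCoeffs : List ℤ → Poly → Poly
mulCoeffs []       Q = 0ₚ
mulCoeffs (c ∷ cs) Q = c ·ₚ Q +ₚ shift (mulCoeffs cs Q)

*ₚ-suc : ∀ P Q k → (P *ₚ Q) (suc k) ≡ P 0 * Q (suc k) + ((λ i → P (suc i)) *ₚ Q) k
*ₚ-suc P Q k = cong (_+_ (P 0 * Q (suc k))) (cong sumℤ
  (trans (ListP.map-applyUpTo suc (λ i → P i * Q (suc k ℕ.∸ i)) (suc k))
         (sym (ListP.map-applyUpTo (λ i → i) (λ i → P (suc i) * Q (k ℕ.∸ i)) (suc k)))))

sumℤ-zeros : {A : Set} (f : A → ℤ) (xs : List A) → (∀ a → f a ≡ + 0) → sumℤ (map f xs) ≡ + 0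
sumℤ-zeros f []       f≡0 = refl
sumℤ-zeros f (x ∷ xs) f≡0 rewrite f≡0 x = trans (ℤP.+-identityˡ _) (sumℤ-zeros f xs f≡0)

*ₚ-congˡ : ∀ {P P′} Q → P ≈ₚ P′ → P *ₚ Q ≈ₚ P′ *ₚ Q
*ₚ-congˡ Q e k = cong sumℤ (ListP.map-cong (λ i → cong (_* Q (k ℕ.∸ i)) (e i)) (upTo (suc k)))

*ₚ-congʳ : ∀ P {Q Q′} → Q ≈ₚ Q′ → P *ₚ Q ≈ₚ P *ₚ Q′
*ₚ-congʳ P e k = cong sumℤ (ListP.map-cong (λ i → cong (_*_ (P i)) (e (k ℕ.∸ i))) (upTo (suc k)))

coeffs-mul : ∀ cs Q → coeffs cs *ₚ Q ≈ₚ mulCoeffs cs Q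
coeffs-mul []       Q k       = sumℤ-zeros (λ i → + 0 * Q (k ℕ.∸ i)) (upTo (suc k)) (λ i → ℤP.*-zeroˡ (Q (k ℕ.∸ i)))
coeffs-mul (c ∷ cs) Q zero    = refl
coeffs-mul (c ∷ cs) Q (suc k) = trans (*ₚ-suc (coeffs (c ∷ cs)) Q k) (cong (_+_ (c * Q (suc k))) (coeffs-mul cs Q k))

const-mul : ∀ c Q → constₚ c *ₚ Q ≈ₚ c ·ₚ Q
const-mul c Q k = trans (*ₚ-congˡ Q const-coeffs k)
  (trans (coeffs-mul (c ∷ []) Q k) (trans (cong (_+_ (c * Q k)) (shift-0 k)) (ℤP.+-identityʳ _)))
  where
  const-coeffs : constₚ c ≈ₚ coeffs (c ∷ [])
  const-coeffs zero    = refl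
  const-coeffs (suc k) = refl

t-mul : ∀ Q → tₚ *ₚ Q ≈ₚ shift Q
t-mul Q k = trans (*ₚ-congˡ Q t-coeffs k) (trans (coeffs-mul (+ 0 ∷ + 1 ∷ []) Q k) (horner k))
  where
  t-coeffs : tₚ ≈ₚ coeffs (+ 0 ∷ + 1 ∷ [])
  t-coeffs zero          = refl
  t-coeffs (suc zero)    = refl
  t-coeffs (suc (suc k)) = refl
  horner : mulCoeffs (+ 0 ∷ + 1 ∷ []) Q ≈ₚ shift Q
  horner zero = identity (Q 0)
    where
    identity : ∀ q → + 0 * q + + 0 ≡ + 0
    identity = solve-∀
  horner (suc k) rewrite shift-0 k = identity (Q (suc k)) (Q k)
    where
    identity : ∀ q₁ q₀ → + 0 * q₁ + (+ 1 * q₀ + + 0) ≡ q₀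
    identity = solve-∀

oneMinusT : Poly
oneMinusT = constₚ (+ 1) -ₚ tₚ

oneMinusT-mul : ∀ Q → oneMinusT *ₚ Q ≈ₚ Q -ₚ shift Q
oneMinusT-mul Q k = trans (*ₚ-congˡ Q oneMinusT-coeffs k) (trans (coeffs-mul (+ 1 ∷ - + 1 ∷ []) Q k) (horner k))
  where
  oneMinusT-coeffs : oneMinusT ≈ₚ coeffs (+ 1 ∷ - + 1 ∷ [])
  oneMinusT-coeffs zero          = refl
  oneMinusT-coeffs (suc zero)    = refl
  oneMinusT-coeffs (suc (suc k)) = refl
  horner : mulCoeffs (+ 1 ∷ - + 1 ∷ []) Q ≈ₚ Q -ₚ shift Q
  horner zero = identity (Q 0)
    where
    identity : ∀ q → + 1 * q + + 0 ≡ q - + 0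
    identity = solve-∀
  horner (suc k) rewrite shift-0 k = identity (Q (suc k)) (Q k)
    where
    identity : ∀ q₁ q₀ → + 1 * q₁ + (- + 1 * q₀ + + 0) ≡ q₁ - q₀
    identity = solve-∀

alternating-power : ∀ m → oneMinusT ^ₚ m ≈ₚ alternating m
alternating-power zero    = ≈-sym (Weighted.descGen-zero (- + 1) refl)
alternating-power (suc m) = begin
  oneMinusT *ₚ (oneMinusT ^ₚ m)           ≈⟨ *ₚ-congʳ oneMinusT (alternating-power m) ⟩
  oneMinusT *ₚ alternating m              ≈⟨ oneMinusT-mul (alternating m) ⟩
  alternating m -ₚ shift (alternating m)  ≈⟨ ≈-sym (alternating-suc m) ⟩
  alternating (suc m)                     ∎
  where open ≈-Reasoning

t-times-power : ∀ m → tₚ *ₚ (oneMinusT ^ₚ m) ≈ₚ shift (alternating m)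
t-times-power m = ≈-trans (t-mul (oneMinusT ^ₚ m)) (respects shift-linear (alternating-power m))

eulerFactor : ℕ → Poly
eulerFactor m = (constₚ (+ (2 ℕ.* suc m)) *ₚ tₚ) -ₚ tₚ +ₚ constₚ (+ 1)

derivFactor : Poly
derivFactor = constₚ (+ 2) *ₚ tₚ *ₚ oneMinusT

eulerFactor-coeffs : ∀ m → eulerFactor m ≈ₚ coeffs (+ 1 ∷ + (2 ℕ.* suc m) - + 1 ∷ [])
eulerFactor-coeffs m k = trans (cong (λ a → a - tₚ k + constₚ (+ 1) k) (const-mul c tₚ k)) (evaluate k)
  where
  c : ℤ
  c = + (2 ℕ.* suc m)
  evaluate : ∀ k → c * tₚ k - tₚ k + constₚ (+ 1) k ≡ coeffs (+ 1 ∷ c - + 1 ∷ []) k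
  evaluate zero          = identity c
    where
    identity : ∀ c → c * + 0 - + 0 + + 1 ≡ + 1
    identity = solve-∀
  evaluate (suc zero)    = identity c
    where
    identity : ∀ c → c * + 1 - + 1 + + 0 ≡ c - + 1
    identity = solve-∀
  evaluate (suc (suc k)) = identity c
    where
    identity : ∀ c → c * + 0 - + 0 + + 0 ≡ + 0
    identity = solve-∀

derivFactor-coeffs : derivFactor ≈ₚ coeffs (+ 0 ∷ + 2 ∷ - + 2 ∷ [])
derivFactor-coeffs = begin
  (constₚ (+ 2) *ₚ tₚ) *ₚ oneMinusT       ≈⟨ *ₚ-congˡ oneMinusT two-t ⟩
  coeffs (+ 0 ∷ + 2 ∷ []) *ₚ oneMinusT    ≈⟨ coeffs-mul (+ 0 ∷ + 2 ∷ []) oneMinusT ⟩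
  mulCoeffs (+ 0 ∷ + 2 ∷ []) oneMinusT    ≈⟨ expand ⟩
  coeffs (+ 0 ∷ + 2 ∷ - + 2 ∷ [])         ∎
  where
  open ≈-Reasoning
  two-t : constₚ (+ 2) *ₚ tₚ ≈ₚ coeffs (+ 0 ∷ + 2 ∷ [])
  two-t k = trans (const-mul (+ 2) tₚ k) (evaluate k)
    where
    evaluate : ∀ k → + 2 * tₚ k ≡ coeffs (+ 0 ∷ + 2 ∷ []) k
    evaluate zero          = refl
    evaluate (suc zero)    = refl
    evaluate (suc (suc k)) = refl
  expand : mulCoeffs (+ 0 ∷ + 2 ∷ []) oneMinusT ≈ₚ coeffs (+ 0 ∷ + 2 ∷ - + 2 ∷ [])
  expand zero                = refl
  expand (suc zero)          = refl
  expand (suc (suc zero))    = refl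
  expand (suc (suc (suc k))) = refl

euler-form : ∀ m P → eulerFactor m *ₚ P +ₚ derivFactor *ₚ deriv P ≈ₚ L (+ 1) m P
euler-form m P k =
  trans (cong₂ _+_ (trans (*ₚ-congˡ P (eulerFactor-coeffs m) k) (coeffs-mul (+ 1 ∷ + (2 ℕ.* suc m) - + 1 ∷ []) P k))
                   (trans (*ₚ-congˡ (deriv P) derivFactor-coeffs k) (coeffs-mul (+ 0 ∷ + 2 ∷ - + 2 ∷ []) (deriv P) k)))
        (evaluate k)
  where
  evaluate : ∀ k → mulCoeffs (+ 1 ∷ + (2 ℕ.* suc m) - + 1 ∷ []) P k
                   + mulCoeffs (+ 0 ∷ + 2 ∷ - + 2 ∷ []) (deriv P) k ≡ L (+ 1) m P k
  evaluate zero = identity (P 0) (deriv P 0)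
    where
    identity : ∀ p₀ d₀ → (+ 1 * p₀ + + 0) + (+ 0 * d₀ + + 0) ≡ p₀ + + 1 * + 0 + (+ 1 + + 1) * + 0
    identity = solve-∀
  evaluate (suc zero) rewrite ℤP.pos-* 2 (suc m) = identity (+ m) (P 1) (P 0) (deriv P 1)
    where
    identity : ∀ M p₁ p₀ d₁ →
      (+ 1 * p₁ + ((+ 2 * (+ 1 + M) - + 1) * p₀ + + 0)) + (+ 0 * d₁ + (+ 2 * (+ 1 * p₁) + + 0))
        ≡ p₁ + + 1 * p₀ + (+ 1 + + 1) * (+ 1 * p₁ + (M - + 0) * p₀)
    identity = solve-∀
  evaluate (suc (suc k)) rewrite ℤP.pos-* 2 (suc m) | shift-0 k =
    identity (+ k) (+ m) (P (suc (suc k))) (P (suc k)) (deriv P (suc (suc k)))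
    where
    identity : ∀ K M p₂ p₁ d₂ →
      (+ 1 * p₂ + ((+ 2 * (+ 1 + M) - + 1) * p₁ + + 0))
        + (+ 0 * d₂ + (+ 2 * ((+ 1 + (+ 1 + K)) * p₂) + (- + 2 * ((+ 1 + K) * p₁) + + 0)))
        ≡ p₂ + + 1 * p₁ + (+ 1 + + 1) * ((+ 1 + (+ 1 + K)) * p₂ + (M - (+ 1 + K)) * p₁)
    identity = solve-∀

sum-difference-injective : ∀ {a b x y} → a + b ≡ x + y → a - b ≡ x - y → a ≡ x × b ≡ y
sum-difference-injective {a} {b} {x} {y} sum diff =
  ℤP.*-cancelˡ-≡ (+ 2) a x (begin
    + 2 * a              ≡⟨ twice-first a b ⟩
    (a + b) + (a - b)    ≡⟨ cong₂ _+_ sum diff ⟩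
    (x + y) + (x - y)    ≡⟨ sym (twice-first x y) ⟩
    + 2 * x              ∎)
  , ℤP.*-cancelˡ-≡ (+ 2) b y (begin
    + 2 * b              ≡⟨ twice-second a b ⟩
    (a + b) - (a - b)    ≡⟨ cong₂ _-_ sum diff ⟩
    (x + y) - (x - y)    ≡⟨ sym (twice-second x y) ⟩
    + 2 * y              ∎)
  where
  open ≡-Reasoning
  twice-first : ∀ a b → + 2 * a ≡ (a + b) + (a - b)
  twice-first = solve-∀
  twice-second : ∀ a b → + 2 * b ≡ (a + b) - (a - b)
  twice-second = solve-∀

sum-recurrence : ∀ m → PD (suc m) +ₚ (+ 1) ·ₚ PD̃ (suc m) ≈ₚ L (+ 1) m (PD m) +ₚ (+ 1) ·ₚ L (+ 1) m (PD̃ m)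
sum-recurrence m = begin
  PD (suc m) +ₚ (+ 1) ·ₚ PD̃ (suc m)              ≈⟨ ≈-sym (descGen-count (suc m)) ⟩
  descGen (suc m)                                 ≈⟨ descGen-suc m ⟩
  L (+ 1) m (descGen m)                           ≈⟨ respects (L-linear (+ 1) m) (descGen-count m) ⟩
  L (+ 1) m (PD m +ₚ (+ 1) ·ₚ PD̃ m)              ≈⟨ linear-combination (L-linear (+ 1) m) (+ 1) (PD m) (PD̃ m) ⟩
  L (+ 1) m (PD m) +ₚ (+ 1) ·ₚ L (+ 1) m (PD̃ m)  ∎
  where
  open ≈-Reasoning
  open Weighted (+ 1) refl

difference-recurrence : ∀ m → PD (suc m) +ₚ (- + 1) ·ₚ PD̃ (suc m) ≈ₚ alternating m -ₚ shift (alternating m)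
difference-recurrence m = ≈-trans (≈-sym (Weighted.descGen-count (- + 1) refl (suc m))) (alternating-suc m)

L-plus-difference : ∀ m → L (+ 1) m (PD m) +ₚ (- + 1) ·ₚ L (+ 1) m (PD̃ m) ≈ₚ alternating m +ₚ shift (alternating m)
L-plus-difference m = begin
  L (+ 1) m (PD m) +ₚ (- + 1) ·ₚ L (+ 1) m (PD̃ m)
    ≈⟨ ≈-sym (linear-combination (L-linear (+ 1) m) (- + 1) (PD m) (PD̃ m)) ⟩
  L (+ 1) m (PD m +ₚ (- + 1) ·ₚ PD̃ m)
    ≈⟨ respects (L-linear (+ 1) m) (≈-sym (Weighted.descGen-count (- + 1) refl m)) ⟩
  L (+ 1) m (alternating m)
    ≈⟨ L-on-kernel (+ 1) m (alternating m) (Δ-alternating m) ⟩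
  alternating m +ₚ (+ 1) ·ₚ shift (alternating m)
    ≈⟨ +ₚ-congˡ (alternating m) (λ k → ℤP.*-identityˡ (shift (alternating m) k)) ⟩
  alternating m +ₚ shift (alternating m) ∎
  where open ≈-Reasoning

recurrences : ∀ m k → PD (suc m) k ≡ L (+ 1) m (PD m) k - shift (alternating m) k
                    × PD̃ (suc m) k ≡ L (+ 1) m (PD̃ m) k + shift (alternating m) k
recurrences m k = sum-difference-injective
  (begin
    d + d̃               ≡⟨ unit-sum d d̃ ⟩
    d + + 1 * d̃         ≡⟨ sum-recurrence m k ⟩
    u + + 1 * ũ         ≡⟨ rebalance-sum u ũ h ⟩
    (u - h) + (ũ + h)   ∎)
  (begin
    d - d̃               ≡⟨ unit-difference d d̃ ⟩
    d + - + 1 * d̃       ≡⟨ difference-recurrence m k ⟩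
    g - h               ≡⟨ split-difference g h ⟩
    (g + h) - (h + h)   ≡⟨ cong (_- (h + h)) (sym (L-plus-difference m k)) ⟩
    (u + - + 1 * ũ) - (h + h) ≡⟨ rebalance-difference u ũ h ⟩
    (u - h) - (ũ + h)   ∎)
  where
  open ≡-Reasoning
  d d̃ u ũ g h : ℤ
  d = PD (suc m) k
  d̃ = PD̃ (suc m) k
  u = L (+ 1) m (PD m) k
  ũ = L (+ 1) m (PD̃ m) k
  g = alternating m k
  h = shift (alternating m) k
  unit-sum : ∀ a b → a + b ≡ a + + 1 * b
  unit-sum = solve-∀
  unit-difference : ∀ a b → a - b ≡ a + - + 1 * b
  unit-difference = solve-∀
  rebalance-sum : ∀ u ũ h → u + + 1 * ũ ≡ (u - h) + (ũ + h)
  rebalance-sum = solve-∀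
  split-difference : ∀ g h → g - h ≡ (g + h) - (h + h)
  split-difference = solve-∀
  rebalance-difference : ∀ u ũ h → (u + - + 1 * ũ) - (h + h) ≡ (u - h) - (ũ + h)
  rebalance-difference = solve-∀

proposition4p7 : (m : ℕ) →
    (PD (suc m) ≈ₚ (((constₚ (+ (2 Data.Nat.* suc m)) *ₚ tₚ) -ₚ tₚ +ₚ constₚ (+ 1)) *ₚ PD m
                     +ₚ (constₚ (+ 2) *ₚ tₚ *ₚ (constₚ (+ 1) -ₚ tₚ)) *ₚ deriv (PD m)
                     -ₚ tₚ *ₚ ((constₚ (+ 1) -ₚ tₚ) ^ₚ m)))
    × (PD̃ (suc m) ≈ₚ (((constₚ (+ (2 Data.Nat.* suc m)) *ₚ tₚ) -ₚ tₚ +ₚ constₚ (+ 1)) *ₚ PD̃ m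
                     +ₚ (constₚ (+ 2) *ₚ tₚ *ₚ (constₚ (+ 1) -ₚ tₚ)) *ₚ deriv (PD̃ m)
                     +ₚ tₚ *ₚ ((constₚ (+ 1) -ₚ tₚ) ^ₚ m)))
proposition4p7 m = (λ k → trans (proj₁ (recurrences m k)) (cong₂ _-_ (euler (PD m) k) (correction k)))
                 , (λ k → trans (proj₂ (recurrences m k)) (cong₂ _+_ (euler (PD̃ m) k) (correction k)))
  where
  euler : ∀ P → L (+ 1) m P ≈ₚ eulerFactor m *ₚ P +ₚ derivFactor *ₚ deriv P
  euler P = ≈-sym (euler-form m P)
  correction : shift (alternating m) ≈ₚ tₚ *ₚ (oneMinusT ^ₚ m)
  correction = ≈-sym (t-times-power m)
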